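{- Let $d\in\{ -43,-19,-11,-3,3,5,7,11,13,19,23\}$, $K=\mathbb{Q}(\sqrt d)$, $r\ge1$ an integer, $p$ a prime, and $\mathfrak{P}$ the unique prime of $\mathcal{O}_K$ above $2$. Let $(a,b,c)\in\mathcal{O}_K^3$ be a non-trivial solution of $d^ra^p+b^p+c^p=0$ with $(da,b,c)$ primitive, and assume that either the residue degree of $\mathfrak{P}$ is $1$ (then $\mathfrak{P}$ divides exactly one of $a,b,c$), or $2$ is inert in $K$ and $2\mid abc$; in either case assume $\mathfrak{P}\mid b$. Assume $p>5$ if $2$ is inert in $K$ and $p>11$ if $2$ is ramified in $K$. Then the elliptic curve $E:y^2=x(x-d^ra^p)(x+b^p)$ has potentially multiplicative reduction at $\mathfrak{P}$.
   Context: Non-trivial means $abc\ne0$; primitive means pairwise coprime in $\mathcal{O}_K$. The convention $\mathfrak{P}\mid b$ is the paper's standing normalization of the solution. -}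

module Defs where

open import Data.Nat using (ℕ; zero; suc)
open import Data.Integer as ℤ using (ℤ; +_; -[1+_])
open import Data.Integer.Divisibility as ℤD using ()
open import Data.Product using (_×_; _,_; ∃; ∃-syntax; Σ)
open import Data.Sum using (_⊎_)
open import Relation.Binary.PropositionalEquality using (_≡_)
open import Relation.Nullary using (¬_)

data Dval : Set where
  m43 m19 m11 m3 p3 p5 p7 p11 p13 p19 p23 : Dval

dℤ : Dval → ℤ
dℤ m43 = ℤ.- (+ 43)
dℤ m19 = ℤ.- (+ 19)
dℤ m11 = ℤ.- (+ 11)
dℤ m3  = ℤ.- (+ 3)
dℤ p3  = + 3
dℤ p5  = + 5
dℤ p7  = + 7
dℤ p11 = + 11
dℤ p13 = + 13
dℤ p19 = + 19
dℤ p23 = + 23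

-- Behaviour of the rational prime 2 in K = Q(√d):
-- d ≡ 5 (mod 8) : 2 inert;  d ≡ 3 (mod 4) : 2 ramified (no split case occurs).
data TwoBehaviour : Set where
  inert ramified : TwoBehaviour

twoIn : Dval → TwoBehaviour
twoIn m43 = inert
twoIn m19 = inert
twoIn m11 = inert
twoIn m3  = inert
twoIn p3  = ramified
twoIn p5  = inert
twoIn p7  = ramified
twoIn p11 = ramified
twoIn p13 = inert
twoIn p19 = ramified
twoIn p23 = ramified

residueDegree : Dval → ℕ
residueDegree δ with twoIn δ
... | inert = 2
... | ramified = 1

-- O_K = ℤ[ω] with ω = (1+√d)/2 if d ≡ 1 (mod 4), ω = √d if d ≡ 3 (mod 4).
-- ω² = s + t ω ; ωs δ = s, ωt δ = t.
ωs : Dval → ℤ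
ωs m43 = ℤ.- (+ 11)
ωs m19 = ℤ.- (+ 5)
ωs m11 = ℤ.- (+ 3)
ωs m3  = ℤ.- (+ 1)
ωs p5  = + 1
ωs p13 = + 3
ωs δ   = dℤ δ

ωt : Dval → ℤ
ωt δ with twoIn δ
... | ramified = + 0
... | inert = + 1

-- An element x + y ω of O_K, represented by its coordinates (x , y).
OK : Set
OK = ℤ × ℤ

module Arith (δ : Dval) where

  infixl 6 _+ᴷ_
  infixl 7 _*ᴷ_
  infixr 8 _^ᴷ_

  embed : ℤ → OK
  embed n = (n , + 0)

  0ᴷ 1ᴷ 2ᴷ : OK
  0ᴷ = embed (+ 0)
  1ᴷ = embed (+ 1)
  2ᴷ = embed (+ 2)

  _+ᴷ_ : OK → OK → OK
  (x₁ , y₁) +ᴷ (x₂ , y₂) = (ℤ._+_ x₁ x₂ , ℤ._+_ y₁ y₂)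

  _*ᴷ_ : OK → OK → OK
  (x₁ , y₁) *ᴷ (x₂ , y₂) =
    ( ℤ._+_ (ℤ._*_ x₁ x₂) (ℤ._*_ (ωs δ) (ℤ._*_ y₁ y₂))
    , ℤ._+_ (ℤ._+_ (ℤ._*_ x₁ y₂) (ℤ._*_ x₂ y₁)) (ℤ._*_ (ωt δ) (ℤ._*_ y₁ y₂)) )

  _^ᴷ_ : OK → ℕ → OK
  x ^ᴷ zero = 1ᴷ
  x ^ᴷ suc n = x *ᴷ (x ^ᴷ n)

  dᴷ : OK
  dᴷ = embed (dℤ δ)

  _∣ᴷ_ : OK → OK → Set
  u ∣ᴷ v = ∃[ w ] (v ≡ u *ᴷ w)

  Coprimeᴷ : OK → OK → Set
  Coprimeᴷ u v = ∃[ α ] ∃[ β ] (α *ᴷ u +ᴷ β *ᴷ v ≡ 1ᴷ)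

  -- the unique prime 𝔓 of O_K above 2, as a set of elements:
  --  inert:    𝔓 = 2 O_K           = { x + yω : 2 ∣ x, 2 ∣ y }
  --  ramified: 𝔓 = (2 , 1 + √d)    = { x + y√d : x ≡ y (mod 2) }
  In𝔓 : OK → Set
  In𝔓 (x , y) with twoIn δ
  ... | inert = (ℤD._∣_ (+ 2) x) × (ℤD._∣_ (+ 2) y)
  ... | ramified = ℤD._∣_ (+ 2) (ℤ._-_ x y)

  data _∈𝔓^_ : OK → ℕ → Set where
    pow0 : ∀ x → x ∈𝔓^ 0
    gen  : ∀ {k} π y → In𝔓 π → y ∈𝔓^ k → (π *ᴷ y) ∈𝔓^ suc k
    add  : ∀ {k} x y → x ∈𝔓^ suc k → y ∈𝔓^ suc k → (x +ᴷ y) ∈𝔓^ suc k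

  -- v_𝔓(n) < v_𝔓(m)   (with v_𝔓(0) = ∞)
  v𝔓< : OK → OK → Set
  v𝔓< n m = ∃[ k ] ((m ∈𝔓^ k) × ¬ (n ∈𝔓^ k))

  -- E : y² = x (x - A)(x + B) has (roots 0, A, -B)
  -- j(E) = 2^8 (A² + AB + B²)³ / (AB(A+B))².
  jNum : OK → OK → OK
  jNum A B = embed (+ 256) *ᴷ (A *ᴷ A +ᴷ A *ᴷ B +ᴷ B *ᴷ B) ^ᴷ 3

  jDen : OK → OK → OK
  jDen A B = (A *ᴷ B *ᴷ (A +ᴷ B)) ^ᴷ 2

  -- E has potentially multiplicative reduction at 𝔓  :⇔  v_𝔓(j(E)) < 0
  -- (for the curve E_{A,B} : y² = x (x - A)(x + B), assumed non-singular)
  PotMultRed𝔓 : OK → OK → Set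
  PotMultRed𝔓 A B = v𝔓< (jNum A B) (jDen A B)

{-# OPTIONS --safe #-}

-- Put A = dʳaᵖ and B = bᵖ, so that j(E) = 2⁸ (A² + AB + B²)³ / (AB(A + B))².
-- As 𝔓 is the only prime of O_K above 2, an element is a unit at 𝔓 exactly when its
-- norm is odd. From α·da + β·b = 1 and 𝔓 ∣ b the norm of da, hence of A, is odd, and
-- since B ∈ 𝔓 so is the norm of A² + AB + B². Hence the numerator of j(E) has valuation
-- exactly 8e, e = v𝔓(2), while the denominator lies in 𝔓^(2p), and the bounds on p say
-- 8e < 2p. The valuation of the numerator is read off from 𝔓^k = 2^k O_K when 2 is inert
-- and from 𝔓^(2m+j) ⊆ 2^m 𝔓^j when 2 ramifies, where 𝔓² ⊆ (2).

module Submission where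

open import Defs
open import Data.Nat using (ℕ; zero; suc; _≤_; _<_; z≤n; s≤s)
import Data.Nat as ℕ
import Data.Nat.Properties as ℕ
import Data.Nat.Divisibility as ℕ
open import Data.Nat.Primality using (Prime; prime?; euclidsLemma)
open import Data.Integer using (ℤ; +_; -_; _+_; _-_; _*_; _^_; ∣_∣; NonZero)
import Data.Integer.Properties as ℤ
open import Data.Integer.Divisibility.Signed
  using (_∣_; divides; ∣-refl; ∣m⇒∣m*n; ∣n⇒∣m*n; ∣m∣n⇒∣m+n; ∣m∣n⇒∣m-n; ∣m+n∣n⇒∣m; ∣ᵤ⇒∣; ∣⇒∣ᵤ)
import Data.Integer.Divisibility as Unsigned
open import Data.Integer.Tactic.RingSolver using (solve-∀)
open import Data.Product using (_×_; ∃-syntax; _,_; proj₁; proj₂)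
open import Data.Sum using (_⊎_; inj₁; inj₂)
open import Data.Unit using (⊤; tt)
open import Relation.Nullary using (¬_)
open import Relation.Nullary.Decidable using (from-yes)
open import Relation.Binary.PropositionalEquality
  using (_≡_; _≢_; refl; sym; trans; cong; cong₂; subst; module ≡-Reasoning)

Odd : ℤ → Set
Odd z = ¬ (+ 2 ∣ z)

odd-1 : Odd (+ 1)
odd-1 2∣1 with ℕ.∣1⇒≡1 (∣⇒∣ᵤ 2∣1)
... | ()

odd-* : ∀ {m n} → Odd m → Odd n → Odd (m * n)
odd-* {m} {n} m-odd n-odd 2∣m*n
  with euclidsLemma ∣ m ∣ ∣ n ∣ (from-yes (prime? 2)) (subst (2 ℕ.∣_) (ℤ.abs-* m n) (∣⇒∣ᵤ 2∣m*n))
... | inj₁ 2∣m = m-odd (∣ᵤ⇒∣ 2∣m)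
... | inj₂ 2∣n = n-odd (∣ᵤ⇒∣ 2∣n)

odd-*-invˡ : ∀ m n → Odd (m * n) → Odd m
odd-*-invˡ m n m*n-odd 2∣m = m*n-odd (∣m⇒∣m*n n 2∣m)

odd-*-invʳ : ∀ m n → Odd (m * n) → Odd n
odd-*-invʳ m n m*n-odd 2∣n = m*n-odd (∣n⇒∣m*n m 2∣n)

odd⇒odd-+-even : ∀ {m e} → + 2 ∣ e → Odd m → Odd (m + e)
odd⇒odd-+-even 2∣e m-odd 2∣m+e = m-odd (∣m+n∣n⇒∣m 2∣m+e 2∣e)

odd-+-even⇒odd : ∀ {m e} → + 2 ∣ e → Odd (m + e) → Odd m
odd-+-even⇒odd 2∣e m+e-odd 2∣m = m+e-odd (∣m∣n⇒∣m+n 2∣m 2∣e)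

2∣ᵤ⇒2∣ : ∀ a → + 2 Unsigned.∣ a → + 2 ∣ a
2∣ᵤ⇒2∣ a = ∣ᵤ⇒∣

infixr 7.5 _·_

_·_ : ℤ → OK → OK
c · (a , b) = (c * a , c * b)

·-identityˡ : ∀ z → + 1 · z ≡ z
·-identityˡ (a , b) = cong₂ _,_ (ℤ.*-identityˡ a) (ℤ.*-identityˡ b)

·-assoc : ∀ c c′ z → (c * c′) · z ≡ c · c′ · z
·-assoc c c′ (a , b) = cong₂ _,_ (ℤ.*-assoc c c′ a) (ℤ.*-assoc c c′ b)

·-injective : ∀ c .{{_ : NonZero c}} {z z′} → c · z ≡ c · z′ → z ≡ z′
·-injective c c·z≡c·z′ = cong₂ _,_
  (ℤ.*-cancelˡ-≡ c _ _ (cong proj₁ c·z≡c·z′)) (ℤ.*-cancelˡ-≡ c _ _ (cong proj₂ c·z≡c·z′))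

infix 4 _∈2^_

_∈2^_ : OK → ℕ → Set
z ∈2^ k = ∃[ w ] z ≡ (+ 2) ^ k · w

∣×∣⇒∈2 : ∀ {a b} → + 2 ∣ a → + 2 ∣ b → (a , b) ∈2^ 1
∣×∣⇒∈2 (divides q a≡q*2) (divides q′ b≡q′*2) =
  (q , q′) , cong₂ _,_ (trans a≡q*2 (ℤ.*-comm q (+ 2))) (trans b≡q′*2 (ℤ.*-comm q′ (+ 2)))

ωs-odd : ∀ δ → + 2 ∣ ωs δ - + 1
ωs-odd m43 = divides (- + 6) refl
ωs-odd m19 = divides (- + 3) refl
ωs-odd m11 = divides (- + 2) refl
ωs-odd m3  = divides (- + 1) refl
ωs-odd p3  = divides (+ 1) refl
ωs-odd p5  = divides (+ 0) refl
ωs-odd p7  = divides (+ 3) refl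
ωs-odd p11 = divides (+ 5) refl
ωs-odd p13 = divides (+ 1) refl
ωs-odd p19 = divides (+ 9) refl
ωs-odd p23 = divides (+ 11) refl

ramificationIndex : TwoBehaviour → ℕ
ramificationIndex inert    = 1
ramificationIndex ramified = 2

module AtTwo (δ : Dval) where
  open Arith δ public

  *-comm : ∀ x y → x *ᴷ y ≡ y *ᴷ x
  *-comm (a , b) (c , d) = cong₂ _,_
    (cong₂ _+_ (ℤ.*-comm a c) (cong (ωs δ *_) (ℤ.*-comm b d)))
    (cong₂ _+_ (ℤ.+-comm (a * d) (c * b)) (cong (ωt δ *_) (ℤ.*-comm b d)))

  *-assoc : ∀ x y z → (x *ᴷ y) *ᴷ z ≡ x *ᴷ (y *ᴷ z)
  *-assoc (a , b) (c , d) (e , f) =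
    cong₂ _,_ (first (ωs δ) (ωt δ) a b c d e f) (second (ωs δ) (ωt δ) a b c d e f)
    where
    first : ∀ s t a b c d e f →
      let u = a * c + s * (b * d); v = a * d + c * b + t * (b * d)
          u′ = c * e + s * (d * f); v′ = c * f + e * d + t * (d * f)
      in u * e + s * (v * f) ≡ a * u′ + s * (b * v′)
    first = solve-∀
    second : ∀ s t a b c d e f →
      let u = a * c + s * (b * d); v = a * d + c * b + t * (b * d)
          u′ = c * e + s * (d * f); v′ = c * f + e * d + t * (d * f)
      in u * f + e * v + t * (v * f) ≡ a * v′ + u′ * b + t * (b * v′)
    second = solve-∀

  *-distribʳ-+ : ∀ x y z → (x +ᴷ y) *ᴷ z ≡ x *ᴷ z +ᴷ y *ᴷ z
  *-distribʳ-+ (a , b) (a′ , b′) (c , d) =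
    cong₂ _,_ (first (ωs δ) a b a′ b′ c d) (second (ωt δ) a b a′ b′ c d)
    where
    first : ∀ s a b a′ b′ c d →
      (a + a′) * c + s * ((b + b′) * d) ≡ a * c + s * (b * d) + (a′ * c + s * (b′ * d))
    first = solve-∀
    second : ∀ t a b a′ b′ c d →
      (a + a′) * d + c * (b + b′) + t * ((b + b′) * d)
        ≡ a * d + c * b + t * (b * d) + (a′ * d + c * b′ + t * (b′ * d))
    second = solve-∀

  *-· : ∀ x k y → x *ᴷ k · y ≡ k · (x *ᴷ y)
  *-· (a , b) k (c , d) = cong₂ _,_ (first (ωs δ) a b k c d) (second (ωt δ) a b k c d)
    where
    first : ∀ s a b k c d → a * (k * c) + s * (b * (k * d)) ≡ k * (a * c + s * (b * d))
    first = solve-∀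
    second : ∀ t a b k c d →
      a * (k * d) + k * c * b + t * (b * (k * d)) ≡ k * (a * d + c * b + t * (b * d))
    second = solve-∀

  ·-* : ∀ k x y → k · x *ᴷ y ≡ k · (x *ᴷ y)
  ·-* k x y = begin
    k · x *ᴷ y     ≡⟨ *-comm (k · x) y ⟩
    y *ᴷ k · x     ≡⟨ *-· y k x ⟩
    k · (y *ᴷ x)   ≡⟨ cong (k ·_) (*-comm y x) ⟩
    k · (x *ᴷ y)   ∎
    where open ≡-Reasoning

  ·-+ : ∀ k x y → k · (x +ᴷ y) ≡ k · x +ᴷ k · y
  ·-+ k (a , b) (a′ , b′) = cong₂ _,_ (ℤ.*-distribˡ-+ k a a′) (ℤ.*-distribˡ-+ k b b′)

  embed-* : ∀ k z → embed k *ᴷ z ≡ k · z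
  embed-* k (a , b) = cong₂ _,_ (first (ωs δ) k a b) (second (ωt δ) k a b)
    where
    first : ∀ s k a b → k * a + s * (+ 0 * b) ≡ k * a
    first = solve-∀
    second : ∀ t k a b → k * b + a * + 0 + t * (+ 0 * b) ≡ k * b
    second = solve-∀

  -- N(a + bω) = (a + bω)(a + bω̄), and ω² = s + tω gives ω + ω̄ = t, ω ω̄ = -s.
  norm : OK → ℤ
  norm (a , b) = a * a + ωt δ * (a * b) - ωs δ * (b * b)

  -- Tr(x ȳ)
  polar : OK → OK → ℤ
  polar (a , b) (c , d) = + 2 * (a * c - ωs δ * (b * d)) + ωt δ * (a * d + b * c)

  norm-1 : norm 1ᴷ ≡ + 1
  norm-1 = identity (ωs δ) (ωt δ)
    where
    identity : ∀ s t → + 1 * + 1 + t * (+ 1 * + 0) - s * (+ 0 * + 0) ≡ + 1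
    identity = solve-∀

  norm-* : ∀ x y → norm (x *ᴷ y) ≡ norm x * norm y
  norm-* (a , b) (c , d) = identity (ωs δ) (ωt δ) a b c d
    where
    identity : ∀ s t a b c d →
      let u = a * c + s * (b * d); v = a * d + c * b + t * (b * d)
      in u * u + t * (u * v) - s * (v * v)
           ≡ (a * a + t * (a * b) - s * (b * b)) * (c * c + t * (c * d) - s * (d * d))
    identity = solve-∀

  norm-+ : ∀ x y → norm (x +ᴷ y) ≡ norm x + (polar x y + norm y)
  norm-+ (a , b) (c , d) = identity (ωs δ) (ωt δ) a b c d
    where
    identity : ∀ s t a b c d →
      (a + c) * (a + c) + t * ((a + c) * (b + d)) - s * ((b + d) * (b + d))
        ≡ a * a + t * (a * b) - s * (b * b)
          + (+ 2 * (a * c - s * (b * d)) + t * (a * d + b * c) + (c * c + t * (c * d) - s * (d * d)))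
    identity = solve-∀

  In𝔓⇒2∣norm : ∀ x → In𝔓 x → + 2 ∣ norm x
  In𝔓⇒2∣norm (a , b) x∈𝔓 with twoIn δ
  In𝔓⇒2∣norm (a , b) (2∣a , 2∣b) | inert =
    ∣m∣n⇒∣m-n (∣m∣n⇒∣m+n (∣m⇒∣m*n a (2∣ᵤ⇒2∣ a 2∣a)) (∣n⇒∣m*n (+ 1) (∣n⇒∣m*n a (2∣ᵤ⇒2∣ b 2∣b))))
              (∣n⇒∣m*n (ωs δ) (∣m⇒∣m*n b (2∣ᵤ⇒2∣ b 2∣b)))
  In𝔓⇒2∣norm (a , b) 2∣a-b | ramified = subst (+ 2 ∣_) (sym (identity (ωs δ) a b))
    (∣m∣n⇒∣m-n (∣m⇒∣m*n (a + b) (2∣ᵤ⇒2∣ (a - b) 2∣a-b)) (∣m⇒∣m*n (b * b) (ωs-odd δ)))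
    where
    identity : ∀ s a b → a * a + + 0 * (a * b) - s * (b * b) ≡ (a - b) * (a + b) - (s - + 1) * (b * b)
    identity = solve-∀

  In𝔓⇒2∣polar : ∀ x y → In𝔓 y → + 2 ∣ polar x y
  In𝔓⇒2∣polar (a , b) (c , d) y∈𝔓 with twoIn δ
  In𝔓⇒2∣polar (a , b) (c , d) (2∣c , 2∣d) | inert =
    ∣m∣n⇒∣m+n (∣m⇒∣m*n (a * c - ωs δ * (b * d)) ∣-refl)
              (∣n⇒∣m*n (+ 1) (∣m∣n⇒∣m+n (∣n⇒∣m*n a (2∣ᵤ⇒2∣ d 2∣d)) (∣n⇒∣m*n b (2∣ᵤ⇒2∣ c 2∣c))))
  In𝔓⇒2∣polar (a , b) (c , d) _ | ramified =
    ∣m∣n⇒∣m+n (∣m⇒∣m*n (a * c - ωs δ * (b * d)) ∣-refl) (divides (+ 0) refl)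

  In𝔓-+ : ∀ x y → In𝔓 x → In𝔓 y → In𝔓 (x +ᴷ y)
  In𝔓-+ (a , b) (c , d) x∈𝔓 y∈𝔓 with twoIn δ
  In𝔓-+ (a , b) (c , d) (2∣a , 2∣b) (2∣c , 2∣d) | inert =
    ∣⇒∣ᵤ (∣m∣n⇒∣m+n (2∣ᵤ⇒2∣ a 2∣a) (2∣ᵤ⇒2∣ c 2∣c)) , ∣⇒∣ᵤ (∣m∣n⇒∣m+n (2∣ᵤ⇒2∣ b 2∣b) (2∣ᵤ⇒2∣ d 2∣d))
  In𝔓-+ (a , b) (c , d) 2∣a-b 2∣c-d | ramified = ∣⇒∣ᵤ (subst (+ 2 ∣_) (sym (identity a b c d))
    (∣m∣n⇒∣m+n (2∣ᵤ⇒2∣ (a - b) 2∣a-b) (2∣ᵤ⇒2∣ (c - d) 2∣c-d)))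
    where
    identity : ∀ a b c d → (a + c) - (b + d) ≡ (a - b) + (c - d)
    identity = solve-∀

  In𝔓-*ʳ : ∀ x y → In𝔓 x → In𝔓 (x *ᴷ y)
  In𝔓-*ʳ (a , b) (c , d) x∈𝔓 with twoIn δ
  In𝔓-*ʳ (a , b) (c , d) (2∣a , 2∣b) | inert =
    ∣⇒∣ᵤ (∣m∣n⇒∣m+n (∣m⇒∣m*n c 2∣a′) (∣n⇒∣m*n (ωs δ) (∣m⇒∣m*n d 2∣b′))) ,
    ∣⇒∣ᵤ (∣m∣n⇒∣m+n (∣m∣n⇒∣m+n (∣m⇒∣m*n d 2∣a′) (∣n⇒∣m*n c 2∣b′)) (∣n⇒∣m*n (+ 1) (∣m⇒∣m*n d 2∣b′)))
    where
    2∣a′ : + 2 ∣ a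
    2∣a′ = 2∣ᵤ⇒2∣ a 2∣a
    2∣b′ : + 2 ∣ b
    2∣b′ = 2∣ᵤ⇒2∣ b 2∣b
  In𝔓-*ʳ (a , b) (c , d) 2∣a-b | ramified = ∣⇒∣ᵤ (subst (+ 2 ∣_) (sym (identity (ωs δ) a b c d))
    (∣m∣n⇒∣m+n (∣m⇒∣m*n (c - d) (2∣ᵤ⇒2∣ (a - b) 2∣a-b)) (∣m⇒∣m*n (b * d) (ωs-odd δ))))
    where
    identity : ∀ s a b c d →
      (a * c + s * (b * d)) - (a * d + c * b + + 0 * (b * d)) ≡ (a - b) * (c - d) + (s - + 1) * (b * d)
    identity = solve-∀

  In𝔓-*ˡ : ∀ x y → In𝔓 y → In𝔓 (x *ᴷ y)
  In𝔓-*ˡ x y y∈𝔓 = subst In𝔓 (*-comm y x) (In𝔓-*ʳ y x y∈𝔓)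

  inert-In𝔓⇒∈2 : twoIn δ ≡ inert → ∀ z → In𝔓 z → z ∈2^ 1
  inert-In𝔓⇒∈2 τ≡inert (a , b) z∈𝔓 with twoIn δ
  inert-In𝔓⇒∈2 refl (a , b) (2∣a , 2∣b) | inert = ∣×∣⇒∈2 (2∣ᵤ⇒2∣ a 2∣a) (2∣ᵤ⇒2∣ b 2∣b)

  inert-∈2⇒In𝔓 : twoIn δ ≡ inert → ∀ {z} → z ∈2^ 1 → In𝔓 z
  inert-∈2⇒In𝔓 τ≡inert ((a , b) , refl) with twoIn δ
  inert-∈2⇒In𝔓 refl ((a , b) , refl) | inert =
    ∣⇒∣ᵤ (∣m⇒∣m*n a (∣-refl {x = + 2})) , ∣⇒∣ᵤ (∣m⇒∣m*n b (∣-refl {x = + 2}))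

  ramified-In𝔓-*⇒∈2 : twoIn δ ≡ ramified → ∀ x y → In𝔓 x → In𝔓 y → x *ᴷ y ∈2^ 1
  ramified-In𝔓-*⇒∈2 τ≡ramified (a , b) (c , d) x∈𝔓 y∈𝔓 with twoIn δ
  ramified-In𝔓-*⇒∈2 refl (a , b) (c , d) x∈𝔓 y∈𝔓 | ramified = ∣×∣⇒∈2
    (subst (+ 2 ∣_) (sym (first (ωs δ) a b c d))
      (∣m∣n⇒∣m+n (∣m∣n⇒∣m+n (∣m∣n⇒∣m+n (∣m⇒∣m*n c 2∣a-b) (∣n⇒∣m*n b 2∣c-d)) (∣m⇒∣m*n (b * d) (ωs-odd δ)))
                 (∣m⇒∣m*n (b * d) ∣-refl)))
    (subst (+ 2 ∣_) (sym (second a b c d))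
      (∣m∣n⇒∣m+n (∣m∣n⇒∣m+n (∣m⇒∣m*n d 2∣a-b) (∣m⇒∣m*n b 2∣c-d)) (∣m⇒∣m*n (b * d) ∣-refl)))
    where
    2∣a-b : + 2 ∣ a - b
    2∣a-b = 2∣ᵤ⇒2∣ (a - b) x∈𝔓
    2∣c-d : + 2 ∣ c - d
    2∣c-d = 2∣ᵤ⇒2∣ (c - d) y∈𝔓
    first : ∀ s a b c d →
      a * c + s * (b * d) ≡ (a - b) * c + b * (c - d) + (s - + 1) * (b * d) + + 2 * (b * d)
    first = solve-∀
    second : ∀ a b c d → a * d + c * b + + 0 * (b * d) ≡ (a - b) * d + (c - d) * b + + 2 * (b * d)
    second = solve-∀

  OddNorm : OK → Set
  OddNorm x = Odd (norm x)

  oddNorm-1 : OddNorm 1ᴷ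
  oddNorm-1 = subst Odd (sym norm-1) odd-1

  oddNorm-* : ∀ x y → OddNorm x → OddNorm y → OddNorm (x *ᴷ y)
  oddNorm-* x y x-unit y-unit = subst Odd (sym (norm-* x y)) (odd-* x-unit y-unit)

  oddNorm-*-invˡ : ∀ x y → OddNorm (x *ᴷ y) → OddNorm x
  oddNorm-*-invˡ x y xy-unit = odd-*-invˡ (norm x) (norm y) (subst Odd (norm-* x y) xy-unit)

  oddNorm-*-invʳ : ∀ x y → OddNorm (x *ᴷ y) → OddNorm y
  oddNorm-*-invʳ x y xy-unit = odd-*-invʳ (norm x) (norm y) (subst Odd (norm-* x y) xy-unit)

  oddNorm-^ : ∀ x n → OddNorm x → OddNorm (x ^ᴷ n)
  oddNorm-^ x zero    x-unit = oddNorm-1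
  oddNorm-^ x (suc n) x-unit = oddNorm-* x (x ^ᴷ n) x-unit (oddNorm-^ x n x-unit)

  oddNorm⇒∉𝔓 : ∀ x → OddNorm x → ¬ In𝔓 x
  oddNorm⇒∉𝔓 x x-unit x∈𝔓 = x-unit (In𝔓⇒2∣norm x x∈𝔓)

  In𝔓⇒2∣polar+norm : ∀ x y → In𝔓 y → + 2 ∣ polar x y + norm y
  In𝔓⇒2∣polar+norm x y y∈𝔓 = ∣m∣n⇒∣m+n (In𝔓⇒2∣polar x y y∈𝔓) (In𝔓⇒2∣norm y y∈𝔓)

  oddNorm-+𝔓 : ∀ x y → In𝔓 y → OddNorm x → OddNorm (x +ᴷ y)
  oddNorm-+𝔓 x y y∈𝔓 x-unit =
    subst Odd (sym (norm-+ x y)) (odd⇒odd-+-even (In𝔓⇒2∣polar+norm x y y∈𝔓) x-unit)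

  oddNorm-+𝔓-inv : ∀ x y → In𝔓 y → OddNorm (x +ᴷ y) → OddNorm x
  oddNorm-+𝔓-inv x y y∈𝔓 x+y-unit =
    odd-+-even⇒odd (In𝔓⇒2∣polar+norm x y y∈𝔓) (subst Odd (norm-+ x y) x+y-unit)

  coprime⇒oddNorm : ∀ x b → Coprimeᴷ x b → In𝔓 b → OddNorm x
  coprime⇒oddNorm x b (α , β , αx+βb≡1) b∈𝔓 =
    oddNorm-*-invʳ α x
      (oddNorm-+𝔓-inv (α *ᴷ x) (β *ᴷ b) (In𝔓-*ˡ β b b∈𝔓) (subst OddNorm (sym αx+βb≡1) oddNorm-1))

  oddNorm-A²+AB+B² : ∀ A B → OddNorm A → In𝔓 B → OddNorm (A *ᴷ A +ᴷ A *ᴷ B +ᴷ B *ᴷ B)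
  oddNorm-A²+AB+B² A B A-unit B∈𝔓 =
    oddNorm-+𝔓 (A *ᴷ A +ᴷ A *ᴷ B) (B *ᴷ B) (In𝔓-*ˡ B B B∈𝔓)
      (oddNorm-+𝔓 (A *ᴷ A) (A *ᴷ B) (In𝔓-*ˡ A B B∈𝔓) (oddNorm-* A A A-unit A-unit))

  ∈𝔓^-*ʳ : ∀ {k x} z → x ∈𝔓^ k → (x *ᴷ z) ∈𝔓^ k
  ∈𝔓^-*ʳ z (pow0 x) = pow0 (x *ᴷ z)
  ∈𝔓^-*ʳ z (gen π y π∈𝔓 y∈𝔓^k) =
    subst (_∈𝔓^ _) (sym (*-assoc π y z)) (gen π (y *ᴷ z) π∈𝔓 (∈𝔓^-*ʳ z y∈𝔓^k))
  ∈𝔓^-*ʳ z (add x y x∈𝔓^k y∈𝔓^k) =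
    subst (_∈𝔓^ _) (sym (*-distribʳ-+ x y z)) (add (x *ᴷ z) (y *ᴷ z) (∈𝔓^-*ʳ z x∈𝔓^k) (∈𝔓^-*ʳ z y∈𝔓^k))

  ∈𝔓^-*ˡ : ∀ {k y} z → y ∈𝔓^ k → (z *ᴷ y) ∈𝔓^ k
  ∈𝔓^-*ˡ {y = y} z y∈𝔓^k = subst (_∈𝔓^ _) (*-comm y z) (∈𝔓^-*ʳ z y∈𝔓^k)

  *-∈𝔓^ : ∀ {k m x y} → x ∈𝔓^ k → y ∈𝔓^ m → (x *ᴷ y) ∈𝔓^ (k ℕ.+ m)
  *-∈𝔓^ (pow0 x) y∈𝔓^m = ∈𝔓^-*ˡ x y∈𝔓^m
  *-∈𝔓^ {y = y′} (gen π y π∈𝔓 y∈𝔓^k) y′∈𝔓^m =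
    subst (_∈𝔓^ _) (sym (*-assoc π y y′)) (gen π (y *ᴷ y′) π∈𝔓 (*-∈𝔓^ y∈𝔓^k y′∈𝔓^m))
  *-∈𝔓^ {y = z} (add x y x∈𝔓^k y∈𝔓^k) z∈𝔓^m =
    subst (_∈𝔓^ _) (sym (*-distribʳ-+ x y z)) (add (x *ᴷ z) (y *ᴷ z) (*-∈𝔓^ x∈𝔓^k z∈𝔓^m) (*-∈𝔓^ y∈𝔓^k z∈𝔓^m))

  ^-∈𝔓^ : ∀ {k x} n → x ∈𝔓^ k → (x ^ᴷ n) ∈𝔓^ (n ℕ.* k)
  ^-∈𝔓^ zero    x∈𝔓^k = pow0 1ᴷ
  ^-∈𝔓^ (suc n) x∈𝔓^k = *-∈𝔓^ x∈𝔓^k (^-∈𝔓^ n x∈𝔓^k)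

  In𝔓⇒^∈𝔓^ : ∀ x n → In𝔓 x → (x ^ᴷ n) ∈𝔓^ n
  In𝔓⇒^∈𝔓^ x zero    x∈𝔓 = pow0 1ᴷ
  In𝔓⇒^∈𝔓^ x (suc n) x∈𝔓 = gen x (x ^ᴷ n) x∈𝔓 (In𝔓⇒^∈𝔓^ x n x∈𝔓)

  ∈𝔓^suc⇒In𝔓 : ∀ {k x} → x ∈𝔓^ suc k → In𝔓 x
  ∈𝔓^suc⇒In𝔓 (gen π y π∈𝔓 _) = In𝔓-*ʳ π y π∈𝔓
  ∈𝔓^suc⇒In𝔓 (add x y x∈𝔓^k y∈𝔓^k) = In𝔓-+ x y (∈𝔓^suc⇒In𝔓 x∈𝔓^k) (∈𝔓^suc⇒In𝔓 y∈𝔓^k)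

  ∈𝔓^-antimono : ∀ {k m x} → k ≤ m → x ∈𝔓^ m → x ∈𝔓^ k
  ∈𝔓^-antimono {x = x} z≤n _ = pow0 x
  ∈𝔓^-antimono (s≤s k≤m) (gen π y π∈𝔓 y∈𝔓^m) = gen π y π∈𝔓 (∈𝔓^-antimono k≤m y∈𝔓^m)
  ∈𝔓^-antimono k≤m@(s≤s _) (add x y x∈𝔓^m y∈𝔓^m) =
    add x y (∈𝔓^-antimono k≤m x∈𝔓^m) (∈𝔓^-antimono k≤m y∈𝔓^m)

  jDen-∈𝔓^ : ∀ {k} A {B} → B ∈𝔓^ k → jDen A B ∈𝔓^ (2 ℕ.* k)
  jDen-∈𝔓^ A {B} B∈𝔓^k = ^-∈𝔓^ 2 (∈𝔓^-*ʳ (A +ᴷ B) (∈𝔓^-*ˡ A B∈𝔓^k))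

  inert-∈𝔓^⇒∈2^ : twoIn δ ≡ inert → ∀ {k x} → x ∈𝔓^ k → x ∈2^ k
  inert-∈𝔓^⇒∈2^ τ≡inert (pow0 x) = x , sym (·-identityˡ x)
  inert-∈𝔓^⇒∈2^ τ≡inert (gen {k} π y π∈𝔓 y∈𝔓^k)
    with inert-In𝔓⇒∈2 τ≡inert π π∈𝔓 | inert-∈𝔓^⇒∈2^ τ≡inert y∈𝔓^k
  ... | π′ , π≡2π′ | w , y≡2^kw = π′ *ᴷ w , (begin
    π *ᴷ y                              ≡⟨ cong₂ _*ᴷ_ π≡2π′ y≡2^kw ⟩
    + 2 · π′ *ᴷ (+ 2) ^ k · w           ≡⟨ ·-* (+ 2) π′ ((+ 2) ^ k · w) ⟩
    + 2 · (π′ *ᴷ (+ 2) ^ k · w)         ≡⟨ cong (+ 2 ·_) (*-· π′ ((+ 2) ^ k) w) ⟩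
    + 2 · (+ 2) ^ k · (π′ *ᴷ w)         ≡⟨ ·-assoc (+ 2) ((+ 2) ^ k) (π′ *ᴷ w) ⟨
    (+ 2) ^ suc k · (π′ *ᴷ w)           ∎)
    where open ≡-Reasoning
  inert-∈𝔓^⇒∈2^ τ≡inert (add {k} x y x∈𝔓^k y∈𝔓^k)
    with inert-∈𝔓^⇒∈2^ τ≡inert x∈𝔓^k | inert-∈𝔓^⇒∈2^ τ≡inert y∈𝔓^k
  ... | w , x≡2^kw | w′ , y≡2^kw′ =
    w +ᴷ w′ , trans (cong₂ _+ᴷ_ x≡2^kw y≡2^kw′) (sym (·-+ ((+ 2) ^ suc k) w w′))

  -- Membership in 2^m 𝔓^j for k = 2m + j, j ≤ 1; this contains 𝔓^k once 𝔓² ⊆ (2).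
  infix 4 _∈𝔓ᵣ^_
  _∈𝔓ᵣ^_ : OK → ℕ → Set
  z ∈𝔓ᵣ^ zero          = ⊤
  z ∈𝔓ᵣ^ suc zero      = In𝔓 z
  z ∈𝔓ᵣ^ suc (suc k)   = ∃[ w ] z ≡ + 2 · w × w ∈𝔓ᵣ^ k

  +-∈𝔓ᵣ^ : ∀ k x y → x ∈𝔓ᵣ^ k → y ∈𝔓ᵣ^ k → x +ᴷ y ∈𝔓ᵣ^ k
  +-∈𝔓ᵣ^ zero          x y _ _ = tt
  +-∈𝔓ᵣ^ (suc zero)    x y = In𝔓-+ x y
  +-∈𝔓ᵣ^ (suc (suc k)) x y (w , x≡2w , w∈) (w′ , y≡2w′ , w′∈) =
    w +ᴷ w′ , trans (cong₂ _+ᴷ_ x≡2w y≡2w′) (sym (·-+ (+ 2) w w′)) , +-∈𝔓ᵣ^ k w w′ w∈ w′∈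

  ramified-In𝔓-*-∈𝔓ᵣ^ : twoIn δ ≡ ramified → ∀ k π y → In𝔓 π → y ∈𝔓ᵣ^ k → π *ᴷ y ∈𝔓ᵣ^ suc k
  ramified-In𝔓-*-∈𝔓ᵣ^ τ≡ramified zero π y π∈𝔓 _ = In𝔓-*ʳ π y π∈𝔓
  ramified-In𝔓-*-∈𝔓ᵣ^ τ≡ramified (suc zero) π y π∈𝔓 y∈𝔓
    with ramified-In𝔓-*⇒∈2 τ≡ramified π y π∈𝔓 y∈𝔓
  ... | w , πy≡2w = w , πy≡2w , tt
  ramified-In𝔓-*-∈𝔓ᵣ^ τ≡ramified (suc (suc k)) π y π∈𝔓 (w , y≡2w , w∈) =
    π *ᴷ w , trans (cong (π *ᴷ_) y≡2w) (*-· π (+ 2) w) , ramified-In𝔓-*-∈𝔓ᵣ^ τ≡ramified k π w π∈𝔓 w∈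

  ramified-∈𝔓^⇒∈𝔓ᵣ^ : twoIn δ ≡ ramified → ∀ {k x} → x ∈𝔓^ k → x ∈𝔓ᵣ^ k
  ramified-∈𝔓^⇒∈𝔓ᵣ^ τ≡ramified (pow0 x) = tt
  ramified-∈𝔓^⇒∈𝔓ᵣ^ τ≡ramified (gen {k} π y π∈𝔓 y∈𝔓^k) =
    ramified-In𝔓-*-∈𝔓ᵣ^ τ≡ramified k π y π∈𝔓 (ramified-∈𝔓^⇒∈𝔓ᵣ^ τ≡ramified y∈𝔓^k)
  ramified-∈𝔓^⇒∈𝔓ᵣ^ τ≡ramified (add {k} x y x∈𝔓^k y∈𝔓^k) =
    +-∈𝔓ᵣ^ (suc k) x y (ramified-∈𝔓^⇒∈𝔓ᵣ^ τ≡ramified x∈𝔓^k) (ramified-∈𝔓^⇒∈𝔓ᵣ^ τ≡ramified y∈𝔓^k)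

  2^n·-cancel-∈𝔓ᵣ^ : ∀ n k z → (+ 2) ^ n · z ∈𝔓ᵣ^ n ℕ.* 2 ℕ.+ k → z ∈𝔓ᵣ^ k
  2^n·-cancel-∈𝔓ᵣ^ zero    k z 1z∈ = subst (_∈𝔓ᵣ^ k) (·-identityˡ z) 1z∈
  2^n·-cancel-∈𝔓ᵣ^ (suc n) k z (w , 2^[1+n]z≡2w , w∈) =
    2^n·-cancel-∈𝔓ᵣ^ n k z (subst (_∈𝔓ᵣ^ n ℕ.* 2 ℕ.+ k) (sym 2^nz≡w) w∈)
    where
    2^nz≡w : (+ 2) ^ n · z ≡ w
    2^nz≡w = ·-injective (+ 2) (trans (sym (·-assoc (+ 2) ((+ 2) ^ n) z)) 2^[1+n]z≡2w)

  256·unit∉𝔓^ : ∀ u → OddNorm u → ¬ (+ 256 · u) ∈𝔓^ suc (8 ℕ.* ramificationIndex (twoIn δ))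
  256·unit∉𝔓^ u u-unit = by-cases (twoIn δ) refl
    where
    by-cases : ∀ τ → twoIn δ ≡ τ → ¬ (+ 256 · u) ∈𝔓^ suc (8 ℕ.* ramificationIndex τ)
    by-cases inert τ≡inert 256u∈𝔓⁹ with inert-∈𝔓^⇒∈2^ τ≡inert 256u∈𝔓⁹
    ... | w , 256u≡512w = oddNorm⇒∉𝔓 u u-unit (inert-∈2⇒In𝔓 τ≡inert (w , u≡2w))
      where
      u≡2w : u ≡ + 2 · w
      u≡2w = ·-injective (+ 256) (trans 256u≡512w (·-assoc (+ 256) (+ 2) w))
    by-cases ramified τ≡ramified 256u∈𝔓¹⁷ = oddNorm⇒∉𝔓 u u-unit
      (2^n·-cancel-∈𝔓ᵣ^ 8 1 u (ramified-∈𝔓^⇒∈𝔓ᵣ^ τ≡ramified 256u∈𝔓¹⁷))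

  potMultRed : ∀ {k} A B → OddNorm A → B ∈𝔓^ k → 8 ℕ.* ramificationIndex (twoIn δ) < 2 ℕ.* k →
               PotMultRed𝔓 A B
  potMultRed {suc k} A B A-unit B∈𝔓^k 8e<2k =
    suc (8 ℕ.* ramificationIndex (twoIn δ)) ,
    ∈𝔓^-antimono 8e<2k (jDen-∈𝔓^ A B∈𝔓^k) ,
    λ jNum∈ → 256·unit∉𝔓^ U U-unit (subst (_∈𝔓^ _) jNum≡256·U jNum∈)
    where
    -- U must stay a name: with U unfolded, checking jNum≡256·U makes Agda normalise 256 · U.
    U : OK
    U = (A *ᴷ A +ᴷ A *ᴷ B +ᴷ B *ᴷ B) ^ᴷ 3
    U-unit : OddNorm U
    U-unit = oddNorm-^ (A *ᴷ A +ᴷ A *ᴷ B +ᴷ B *ᴷ B) 3 (oddNorm-A²+AB+B² A B A-unit (∈𝔓^suc⇒In𝔓 B∈𝔓^k))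
    jNum≡256·U : jNum A B ≡ + 256 · U
    jNum≡256·U = embed-* (+ 256) U

8e<2p : ∀ δ p → (twoIn δ ≡ inert → 5 < p) → (twoIn δ ≡ ramified → 11 < p) →
        8 ℕ.* ramificationIndex (twoIn δ) < 2 ℕ.* p
8e<2p δ p p>5 p>11 with twoIn δ
... | inert    = ℕ.≤-trans (ℕ.m≤n+m 9 3) (ℕ.*-monoʳ-≤ 2 (p>5 refl))
... | ramified = ℕ.≤-trans (ℕ.m≤n+m 17 7) (ℕ.*-monoʳ-≤ 2 (p>11 refl))

-- The conclusion names Arith's definitions directly: against the copies made by a
-- let-bound `open Arith δ`, the conversion checker would normalise jNum of d^r a^p and b^p.
mainTheorem6 : (δ : Dval) (r : ℕ) (p : ℕ) (a b c : OK) →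
    let open Arith δ in
    1 ≤ r →
    Prime p →
    (a *ᴷ b *ᴷ c ≢ 0ᴷ) →
    (dᴷ ^ᴷ r *ᴷ a ^ᴷ p +ᴷ b ^ᴷ p +ᴷ c ^ᴷ p ≡ 0ᴷ) →
    Coprimeᴷ (dᴷ *ᴷ a) b → Coprimeᴷ (dᴷ *ᴷ a) c → Coprimeᴷ b c →
    (residueDegree δ ≡ 1 ⊎ (twoIn δ ≡ inert × 2ᴷ ∣ᴷ (a *ᴷ b *ᴷ c))) →
    In𝔓 b →
    (twoIn δ ≡ inert → 5 < p) →
    (twoIn δ ≡ ramified → 11 < p) →
    Arith.PotMultRed𝔓 δ (Arith._*ᴷ_ δ (Arith._^ᴷ_ δ (Arith.dᴷ δ) r) (Arith._^ᴷ_ δ a p)) (Arith._^ᴷ_ δ b p)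
mainTheorem6 δ r p a b c _ _ _ _ da⊥b _ _ _ b∈𝔓 p>5 p>11 =
  potMultRed (Arith._*ᴷ_ δ (Arith._^ᴷ_ δ (Arith.dᴷ δ) r) (Arith._^ᴷ_ δ a p)) (Arith._^ᴷ_ δ b p)
    A-unit (In𝔓⇒^∈𝔓^ b p b∈𝔓) (8e<2p δ p p>5 p>11)
  where
  open AtTwo δ
  da-unit : OddNorm (dᴷ *ᴷ a)
  da-unit = coprime⇒oddNorm (dᴷ *ᴷ a) b da⊥b b∈𝔓
  A-unit : OddNorm (dᴷ ^ᴷ r *ᴷ a ^ᴷ p)
  A-unit = oddNorm-* (dᴷ ^ᴷ r) (a ^ᴷ p)
    (oddNorm-^ dᴷ r (oddNorm-*-invˡ dᴷ a da-unit)) (oddNorm-^ a p (oddNorm-*-invʳ dᴷ a da-unit))
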